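{- Let $r\ge 1$, let $G$, $H$, $H_1,\dots,H_r$ be graphs and let $a_1,\dots,a_r\ge 2$ be integers. If $G \rightarrow (a_1,\dots,a_r)^v$ and $H \rightarrow (H_1,\dots,H_r)^v$, then $G[H] \rightarrow (K_{a_1}[H_1],\dots,K_{a_r}[H_r])^v$.
   Context: For graphs $G, H_1,\dots,H_r$, $G \rightarrow (H_1,\dots,H_r)^v$ means: for every partition $V(G)=X_1\cup\dots\cup X_r$ (i.e. every $r$-coloring of the vertices) there is some $i$ such that the subgraph of $G$ induced by $X_i$ contains a copy of $H_i$. An integer $a$ in an arrowing statement stands for the complete graph $K_a$. The lexicographic product $G[H]$ has vertex set $V(G)\times V(H)$, with $\{(u_1,v_1),(u_2,v_2)\}$ an edge iff $\{u_1,u_2\}\in E(G)$, or $u_1=u_2$ and $\{v_1,v_2\}\in E(H)$. -}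

module Defs where

open import Data.Nat using (ℕ; _*_)
open import Data.Fin using (Fin; remQuot)
open import Data.Product using (Σ; _×_; _,_)
open import Data.Sum using (_⊎_; inj₁; inj₂)
open import Relation.Nullary using (¬_)
open import Relation.Binary.PropositionalEquality as Eq using (_≡_; refl)
open import Function.Definitions using (Injective)

record Graph : Set₁ where
  field
    n      : ℕ
    E      : Fin n → Fin n → Set
    E-sym  : ∀ {x y} → E x y → E y x
    E-irr  : ∀ {x} → ¬ E x x
open Graph public

K : ℕ → Graph
K a = record { n = a ; E = λ x y → ¬ (x ≡ y)
             ; E-sym = λ p q → p (Eq.sym q) ; E-irr = λ p → p refl }

LexE : (G H : Graph) → Fin (n G) × Fin (n H) → Fin (n G) × Fin (n H) → Set
LexE G H (u₁ , v₁) (u₂ , v₂) = E G u₁ u₂ ⊎ (u₁ ≡ u₂ × E H v₁ v₂)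

LexE-sym : (G H : Graph) → ∀ {p q} → LexE G H p q → LexE G H q p
LexE-sym G H {_ , _} {_ , _} (inj₁ e) = inj₁ (E-sym G e)
LexE-sym G H {_ , _} {_ , _} (inj₂ (refl , e)) = inj₂ (refl , E-sym H e)

LexE-irr : (G H : Graph) → ∀ {p} → ¬ LexE G H p p
LexE-irr G H {_ , _} (inj₁ e) = E-irr G e
LexE-irr G H {_ , _} (inj₂ (_ , e)) = E-irr H e

_[_] : Graph → Graph → Graph
G [ H ] = record
  { n = n G * n H
  ; E = λ x y → LexE G H (remQuot (n H) x) (remQuot (n H) y)
  ; E-sym = LexE-sym G H
  ; E-irr = LexE-irr G H
  }

-- the subgraph of G induced by {x | P x} contains a copy of H:
-- an injective, edge-preserving map V(H) → V(G) landing in P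
ContainsIn : (G : Graph) → (Fin (n G) → Set) → Graph → Set
ContainsIn G P H =
  Σ (Fin (n H) → Fin (n G)) λ f →
    Injective _≡_ _≡_ f
    × (∀ x → P (f x))
    × (∀ {x y} → E H x y → E G (f x) (f y))

-- vertex arrowing G → (H₁,…,H_r)^v : every r-colouring of V(G) has a colour i
-- whose class induces a subgraph containing a copy of H_i
Arrows : (G : Graph) (r : ℕ) → (Fin r → Graph) → Set
Arrows G r Hs = (c : Fin (n G) → Fin r) →
  Σ (Fin r) λ i → ContainsIn G (λ x → c x ≡ i) (Hs i)

-- Colour each block {u} × V(H) of G[H] by a colour i_u whose class in the fibre contains a
-- copy of H_{i_u}. By G → (a₁,…,a_r)^v some colour i has a K_{a_i} among the blocks coloured i;
-- placing the copies of H_i in those a_i blocks side by side yields a K_{a_i}[H_i] of colour i.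
module Submission where

open import Defs
open import Data.Nat using (ℕ; _≥_; _*_)
open import Data.Fin using (Fin; combine; remQuot)
open import Data.Fin.Properties using (remQuot-combine; combine-remQuot)
open import Data.Product using (_×_; _,_; proj₁; proj₂; uncurry)
open import Data.Product.Properties using (,-injectiveˡ; ,-injectiveʳ)
open import Data.Sum using (inj₁; inj₂)
open import Relation.Binary.PropositionalEquality
  using (_≡_; refl; sym; trans; cong; subst; subst₂)
open import Function.Definitions using (Injective)

remQuot-injective : ∀ {m} k {z₁ z₂ : Fin (m * k)} → remQuot {m} k z₁ ≡ remQuot k z₂ → z₁ ≡ z₂
remQuot-injective {m} k {z₁} {z₂} eq =
  trans (sym (combine-remQuot {m} k z₁)) (trans (cong (uncurry combine) eq) (combine-remQuot {m} k z₂))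

ContainsIn-mono : ∀ {G H} {P Q : Fin (n G) → Set} → (∀ x → P x → Q x) →
  ContainsIn G P H → ContainsIn G Q H
ContainsIn-mono P⇒Q (f , f-inj , f-P , f-hom) = f , f-inj , (λ x → P⇒Q (f x) (f-P x)) , f-hom

ContainsIn-lex : ∀ {A B G H} {Q : Fin (n G) → Set} {P : Fin (n G) → Fin (n H) → Set} →
  ContainsIn G Q A → (∀ u → Q u → ContainsIn H (P u) B) →
  ContainsIn (G [ H ]) (λ z → uncurry P (remQuot (n H) z)) (A [ B ])
ContainsIn-lex {A} {B} {G} {H} {Q} {P} (f , f-inj , f-Q , f-hom) inner =
  embed , embed-inj , embed-P , embed-hom
  where
  module Fibre (x : Fin (n A)) where
    copy : ContainsIn H (P (f x)) B
    copy = inner (f x) (f-Q x)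
    ψ : Fin (n B) → Fin (n H)
    ψ = proj₁ copy
    ψ-inj : Injective _≡_ _≡_ ψ
    ψ-inj = proj₁ (proj₂ copy)
    ψ-P : ∀ y → P (f x) (ψ y)
    ψ-P = proj₁ (proj₂ (proj₂ copy))
    ψ-hom : ∀ {y₁ y₂} → E B y₁ y₂ → E H (ψ y₁) (ψ y₂)
    ψ-hom = proj₂ (proj₂ (proj₂ copy))
  open Fibre

  onPairs : Fin (n A) × Fin (n B) → Fin (n G) × Fin (n H)
  onPairs (x , y) = f x , ψ x y

  onPairs-inj : ∀ {p q} → onPairs p ≡ onPairs q → p ≡ q
  onPairs-inj {x₁ , y₁} {x₂ , y₂} eq with refl ← f-inj (,-injectiveˡ eq) =
    cong (x₁ ,_) (ψ-inj x₁ (,-injectiveʳ eq))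

  onPairs-hom : ∀ {p q} → LexE A B p q → LexE G H (onPairs p) (onPairs q)
  onPairs-hom (inj₁ x₁≢x₂) = inj₁ (f-hom x₁≢x₂)
  onPairs-hom {x , _} (inj₂ (refl , e)) = inj₂ (refl , ψ-hom x e)

  embed : Fin (n A * n B) → Fin (n G * n H)
  embed z = uncurry combine (onPairs (remQuot (n B) z))

  decode-embed : ∀ z → remQuot (n H) (embed z) ≡ onPairs (remQuot (n B) z)
  decode-embed z = uncurry remQuot-combine (onPairs (remQuot (n B) z))

  embed-inj : Injective _≡_ _≡_ embed
  embed-inj {z₁} {z₂} eq = remQuot-injective (n B) (onPairs-inj
    (trans (sym (decode-embed z₁)) (trans (cong (remQuot (n H)) eq) (decode-embed z₂))))

  onPairs-P : ∀ p → uncurry P (onPairs p)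
  onPairs-P (x , y) = ψ-P x y

  embed-P : ∀ z → uncurry P (remQuot (n H) (embed z))
  embed-P z = subst (uncurry P) (sym (decode-embed z)) (onPairs-P (remQuot (n B) z))

  embed-hom : ∀ {z₁ z₂} → E (A [ B ]) z₁ z₂ → E (G [ H ]) (embed z₁) (embed z₂)
  embed-hom {z₁} {z₂} e = subst₂ (LexE G H) (sym (decode-embed z₁)) (sym (decode-embed z₂))
    (onPairs-hom e)

arrowed-copy : ∀ {H r Hs} (arr : Arrows H r Hs) (c : Fin (n H) → Fin r) {i} →
  proj₁ (arr c) ≡ i → ContainsIn H (λ v → c v ≡ i) (Hs i)
arrowed-copy arr c refl = proj₂ (arr c)

lemma2 : (r : ℕ) → r ≥ 1 → (G H : Graph) (Hs : Fin r → Graph) (a : Fin r → ℕ) →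
    (∀ i → a i ≥ 2) →
    Arrows G r (λ i → K (a i)) →
    Arrows H r Hs →
    Arrows (G [ H ]) r (λ i → K (a i) [ Hs i ])
lemma2 r _ G H Hs a _ G-arrows H-arrows c =
  i , ContainsIn-mono {G = G [ H ]} {H = K (a i) [ Hs i ]} colour-i lexCopy
  where
  fibre : Fin (n G) → Fin (n H) → Fin r
  fibre u v = c (combine u v)
  blockColour : Fin (n G) → Fin r
  blockColour u = proj₁ (H-arrows (fibre u))
  i : Fin r
  i = proj₁ (G-arrows blockColour)
  clique : ContainsIn G (λ u → blockColour u ≡ i) (K (a i))
  clique = proj₂ (G-arrows blockColour)
  colour-i : ∀ z → uncurry fibre (remQuot (n H) z) ≡ i → c z ≡ i
  colour-i z = subst (λ w → c w ≡ i) (combine-remQuot {n G} (n H) z)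
  lexCopy : ContainsIn (G [ H ]) (λ z → uncurry fibre (remQuot (n H) z) ≡ i) (K (a i) [ Hs i ])
  lexCopy = ContainsIn-lex {K (a i)} {Hs i} {G} {H} {P = λ u v → fibre u v ≡ i} clique
    (λ u → arrowed-copy {H} {Hs = Hs} H-arrows (fibre u))
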